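{- Let $W \in \Sigma^{+}$ be a nonempty word over an alphabet $\Sigma$ and let $d$ be a positive integer. Let $x = x_1 x_2 \cdots x_m$ (with $m \ge 1$) be a word in $CN(W,d)$. Then (i) $d_{lev}(x,W) = d$, and (ii) in every optimal alignment between $W$ and $x$, the character $x_m$ appears in a match column.
   Context: For words $U,V$ over $\Sigma$, the Levenshtein distance $d_{lev}(U,V)$ is the minimum number of single-character insertions, deletions and substitutions transforming $U$ into $V$. $N(W,d) = \{U : d_{lev}(U,W) \le d\}$ and $CN(W,d) = N(W,d)\setminus N(W,d)\Sigma^+$ is the set of words in $N(W,d)$ having no proper prefix in $N(W,d)$. An alignment is a two-row array whose rows are words over $\Sigma \cup \{ -\}$ (the symbol $-$ is a gap), with no column containing two gaps; deleting the gaps from the top (resp. bottom) row gives the aligned words. Its cost is the number of columns whose two entries differ. A match column contains the same character of $\Sigma$ twice; a mismatch column contains two different characters of $\Sigma$; a deletion column has a gap at the bottom; an insertion column has a gap at the top. An optimal alignment between $U$ and $V$ is one of minimum cost, which equals $d_{lev}(U,V)$. -}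

module Defs where

open import Data.Nat using (ℕ; zero; suc; _+_; _≤_; _⊓_)
open import Data.List using (List; []; _∷_; _++_; length)
open import Data.List.Relation.Unary.All using (All)
open import Data.Maybe using (Maybe; just; nothing)
open import Data.Maybe.Properties using () renaming (≡-dec to maybe-≡-dec)
open import Data.Product using (_×_; _,_; proj₁; proj₂; Σ; ∃)
open import Relation.Binary.Definitions using (DecidableEquality)
open import Relation.Binary.PropositionalEquality using (_≡_)
open import Relation.Nullary using (¬_; yes; no)

module Lev {A : Set} (_≟_ : DecidableEquality A) where

  subCost : A → A → ℕ
  subCost a b with a ≟ b
  ... | yes _ = 0
  ... | no  _ = 1

  lev : List A → List A → ℕ
  lev [] v = length v
  lev (a ∷ u) [] = suc (length u)
  lev (a ∷ u) (b ∷ v) =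
    suc (lev u (b ∷ v)) ⊓ (suc (lev (a ∷ u) v) ⊓ (lev u v + subCost a b))

  InN : List A → ℕ → List A → Set
  InN W d U = lev U W ≤ d

  -- CN(W,d) = N(W,d) \ N(W,d) Σ⁺ : in N(W,d) and no proper prefix in N(W,d)
  InCN : List A → ℕ → List A → Set
  InCN W d x = InN W d x ×
    (∀ (p : List A) (b : A) (s : List A) → x ≡ p ++ (b ∷ s) → ¬ InN W d p)

  -- Alignment columns: (top entry, bottom entry); nothing = gap.
  Column : Set
  Column = Maybe A × Maybe A

  NotDoubleGap : Column → Set
  NotDoubleGap (t , b) = ¬ (t ≡ nothing × b ≡ nothing)

  row : List (Maybe A) → List A
  row [] = []
  row (nothing ∷ r) = row r
  row (just a ∷ r) = a ∷ row r

  topRow : List Column → List A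
  topRow al = row (Data.List.map proj₁ al)

  bottomRow : List Column → List A
  bottomRow al = row (Data.List.map proj₂ al)

  IsAlignment : List A → List A → List Column → Set
  IsAlignment U V al = All NotDoubleGap al × topRow al ≡ U × bottomRow al ≡ V

  cost : List Column → ℕ
  cost [] = 0
  cost ((t , b) ∷ al) with maybe-≡-dec _≟_ t b
  ... | yes _ = cost al
  ... | no  _ = suc (cost al)

  IsOptimal : List A → List A → List Column → Set
  IsOptimal U V al = IsAlignment U V al ×
    (∀ al′ → IsAlignment U V al′ → cost al ≤ cost al′)

  -- The last character c of the bottom row lies in a match column:
  -- the column holding it (the last column with non-gap bottom) is (c , c).
  LastBottomInMatch : A → List Column → Set
  LastBottomInMatch c al = ∃ λ pre → ∃ λ post →
    al ≡ pre ++ ((just c , just c) ∷ post) ×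
    All (λ col → proj₂ col ≡ nothing) post

{-# OPTIONS --safe #-}
module Submission where

-- Erase the bottom entry of the column of an alignment of W with xs c that
-- holds c (dropping the column if it becomes a double gap).  The result aligns
-- W with xs at a cost at most one higher, and no higher at all unless that
-- column was a match.  As xs ∉ N(W,d) ∋ xs c, the first bound forces
-- d_lev(xs c, W) = d, and the second, applied to an optimal alignment, would
-- put xs into N(W,d) if c were not matched.

open import Defs
open import Data.Nat using (ℕ; suc; _+_; _⊓_; _≤_; z≤n; s≤s)
open import Data.Nat.Properties
  using (≤-refl; ≤-trans; ≤-reflexive; ≤-antisym; ≤-pred; ≰⇒>; n≤1+n; m⊓n≤m; m⊓n≤n; ⊓-sel;
         +-suc; +-comm; +-monoˡ-≤; +-monoʳ-≤; module ≤-Reasoning)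
open import Data.List using (List; []; _∷_; _∷ʳ_; _++_; map)
open import Data.List.Properties using (∷-injective; map-++; ++-identityʳ)
open import Data.List.Relation.Unary.All using (All; []; _∷_)
open import Data.List.Relation.Unary.All.Properties using (++⁺; ++⁻)
open import Data.Maybe using (Maybe; just; nothing)
open import Data.Maybe.Properties using (just-injective) renaming (≡-dec to maybe-≡-dec)
open import Data.Product using (_×_; _,_; proj₁; proj₂; ∃; ∃₂)
open import Data.Sum using (_⊎_; inj₁; inj₂)
open import Function using (_∘_)
open import Relation.Nullary using (¬_; yes; no; contradiction)
open import Relation.Binary.Definitions using (DecidableEquality)
open import Relation.Binary.PropositionalEquality
  using (_≡_; _≢_; refl; sym; trans; cong; cong₂; subst; module ≡-Reasoning)

module Alignments {A : Set} (_≟_ : DecidableEquality A) where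
  open Lev _≟_

  cost-∷-≡ : ∀ {t b : Maybe A} al → t ≡ b → cost ((t , b) ∷ al) ≡ cost al
  cost-∷-≡ {t} {b} al t≡b with maybe-≡-dec _≟_ t b
  ... | yes _   = refl
  ... | no  t≢b = contradiction t≡b t≢b

  cost-∷-≢ : ∀ {t b : Maybe A} al → t ≢ b → cost ((t , b) ∷ al) ≡ suc (cost al)
  cost-∷-≢ {t} {b} al t≢b with maybe-≡-dec _≟_ t b
  ... | yes t≡b = contradiction t≡b t≢b
  ... | no  _   = refl

  cost-∷-just : ∀ a b al → cost ((just a , just b) ∷ al) ≡ subCost b a + cost al
  cost-∷-just a b al with b ≟ a
  ... | yes refl = cost-∷-≡ {just a} al refl
  ... | no  b≢a  = cost-∷-≢ al (b≢a ∘ sym ∘ just-injective)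

  cost-∷-≥ : ∀ col al → cost al ≤ cost (col ∷ al)
  cost-∷-≥ (t , b) al with maybe-≡-dec _≟_ t b
  ... | yes _ = ≤-refl
  ... | no  _ = n≤1+n _

  cost-++-monoʳ : ∀ n pre {al al′} → cost al′ ≤ n + cost al →
                  cost (pre ++ al′) ≤ n + cost (pre ++ al)
  cost-++-monoʳ n []              le = le
  cost-++-monoʳ n ((t , b) ∷ pre) {al} le with maybe-≡-dec _≟_ t b
  ... | yes _ = cost-++-monoʳ n pre le
  ... | no  _ = ≤-trans (s≤s (cost-++-monoʳ n pre le))
                        (≤-reflexive (sym (+-suc n (cost (pre ++ al)))))

  lev-insertion : ∀ b V U → lev (b ∷ V) U ≤ suc (lev V U)
  lev-insertion b []      []      = ≤-refl
  lev-insertion b (_ ∷ _) []      = ≤-refl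
  lev-insertion b V       (_ ∷ _) = m⊓n≤m _ _

  lev-deletion : ∀ V a U → lev V (a ∷ U) ≤ suc (lev V U)
  lev-deletion []      a U = ≤-refl
  lev-deletion (_ ∷ _) a U = ≤-trans (m⊓n≤n _ _) (m⊓n≤m _ _)

  lev-substitution : ∀ b V a U → lev (b ∷ V) (a ∷ U) ≤ lev V U + subCost b a
  lev-substitution b V a U = ≤-trans (m⊓n≤n _ _) (m⊓n≤n _ _)

  lev≤cost : ∀ {U V al} → IsAlignment U V al → lev V U ≤ cost al
  lev≤cost {al = al} (nd , refl , refl) = go al nd
    where
    go : ∀ al → All NotDoubleGap al → lev (bottomRow al) (topRow al) ≤ cost al
    go []                         []       = z≤n
    go ((nothing , nothing) ∷ al) (nd ∷ _) = contradiction (refl , refl) nd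
    go ((just a , nothing) ∷ al)  (_ ∷ nd) =
      ≤-trans (lev-deletion (bottomRow al) a (topRow al)) (s≤s (go al nd))
    go ((nothing , just b) ∷ al)  (_ ∷ nd) =
      ≤-trans (lev-insertion b (bottomRow al) (topRow al)) (s≤s (go al nd))
    go ((just a , just b) ∷ al)   (_ ∷ nd) = begin
      lev (b ∷ bottomRow al) (a ∷ topRow al)       ≤⟨ lev-substitution b (bottomRow al) a (topRow al) ⟩
      lev (bottomRow al) (topRow al) + subCost b a ≡⟨ +-comm _ (subCost b a) ⟩
      subCost b a + lev (bottomRow al) (topRow al) ≤⟨ +-monoʳ-≤ (subCost b a) (go al nd) ⟩
      subCost b a + cost al                        ≡⟨ sym (cost-∷-just a b al) ⟩
      cost ((just a , just b) ∷ al)                ∎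
      where open ≤-Reasoning

  AlignmentWithin : List A → List A → ℕ → Set
  AlignmentWithin U V n = ∃ λ al → IsAlignment U V al × cost al ≤ n

  ⊓-closed : ∀ {P : ℕ → Set} {m n} → P m → P n → P (m ⊓ n)
  ⊓-closed {P} {m} {n} pm pn with ⊓-sel m n
  ... | inj₁ m⊓n≡m = subst P (sym m⊓n≡m) pm
  ... | inj₂ m⊓n≡n = subst P (sym m⊓n≡n) pn

  insertionColumn : ∀ {U V n} b → AlignmentWithin U V n → AlignmentWithin U (b ∷ V) (suc n)
  insertionColumn b (al , (nd , refl , refl) , c≤n) =
    (nothing , just b) ∷ al , (((λ ()) ∘ proj₂) ∷ nd , refl , refl) , s≤s c≤n

  deletionColumn : ∀ {U V n} a → AlignmentWithin U V n → AlignmentWithin (a ∷ U) V (suc n)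
  deletionColumn a (al , (nd , refl , refl) , c≤n) =
    (just a , nothing) ∷ al , (((λ ()) ∘ proj₁) ∷ nd , refl , refl) , s≤s c≤n

  substitutionColumn : ∀ {U V n} a b → AlignmentWithin U V n →
                       AlignmentWithin (a ∷ U) (b ∷ V) (n + subCost b a)
  substitutionColumn a b (al , (nd , refl , refl) , c≤n) =
    (just a , just b) ∷ al , (((λ ()) ∘ proj₁) ∷ nd , refl , refl) ,
    ≤-trans (≤-reflexive (trans (cost-∷-just a b al) (+-comm (subCost b a) (cost al))))
            (+-monoˡ-≤ (subCost b a) c≤n)

  -- The insertion clauses split V so that lev (b ∷ V) [] ≡ suc (lev V []) holds definitionally.
  levAlignment : ∀ U V → AlignmentWithin U V (lev V U)
  levAlignment []      []           = [] , ([] , refl , refl) , z≤n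
  levAlignment []      (b ∷ [])     = insertionColumn b (levAlignment [] [])
  levAlignment []      (b ∷ b′ ∷ V) = insertionColumn b (levAlignment [] (b′ ∷ V))
  levAlignment (a ∷ U) []           = deletionColumn a (levAlignment U [])
  levAlignment (a ∷ U) (b ∷ V)      =
    ⊓-closed {AlignmentWithin (a ∷ U) (b ∷ V)}
      (insertionColumn b (levAlignment (a ∷ U) V))
      (⊓-closed {AlignmentWithin (a ∷ U) (b ∷ V)}
        (deletionColumn a (levAlignment U (b ∷ V)))
        (substitutionColumn a b (levAlignment U V)))

  row-++ : ∀ xs ys → row (xs ++ ys) ≡ row xs ++ row ys
  row-++ []             ys = refl
  row-++ (nothing ∷ xs) ys = row-++ xs ys
  row-++ (just a ∷ xs)  ys = cong (a ∷_) (row-++ xs ys)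

  topRow-++ : ∀ al al′ → topRow (al ++ al′) ≡ topRow al ++ topRow al′
  topRow-++ al al′ = trans (cong row (map-++ proj₁ al al′)) (row-++ (map proj₁ al) (map proj₁ al′))

  bottomRow-++ : ∀ al al′ → bottomRow (al ++ al′) ≡ bottomRow al ++ bottomRow al′
  bottomRow-++ al al′ = trans (cong row (map-++ proj₂ al al′)) (row-++ (map proj₂ al) (map proj₂ al′))

  bottomRow≡[]⇒gaps : ∀ al → bottomRow al ≡ [] → All (λ col → proj₂ col ≡ nothing) al
  bottomRow≡[]⇒gaps []                  _  = []
  bottomRow≡[]⇒gaps ((_ , nothing) ∷ al) eq = refl ∷ bottomRow≡[]⇒gaps al eq

  splitAtLastBottom : ∀ V c al → bottomRow al ≡ V ∷ʳ c →
    ∃₂ λ pre t → ∃ λ post →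
      al ≡ pre ++ (t , just c) ∷ post × bottomRow pre ≡ V × bottomRow post ≡ []
  splitAtLastBottom []      c [] ()
  splitAtLastBottom (_ ∷ _) c [] ()
  splitAtLastBottom V c ((t , nothing) ∷ al) eq
    with pre , t′ , post , refl , bottom-pre , bottom-post ← splitAtLastBottom V c al eq
    = (t , nothing) ∷ pre , t′ , post , refl , bottom-pre , bottom-post
  splitAtLastBottom [] c ((t , just b) ∷ al) eq
    with refl , bottom-al ← ∷-injective eq
    = [] , t , al , refl , refl , bottom-al
  splitAtLastBottom (v ∷ V) c ((t , just b) ∷ al) eq
    with refl , eq′ ← ∷-injective eq
    with pre , t′ , post , refl , bottom-pre , bottom-post ← splitAtLastBottom V c al eq′
    = (t , just v) ∷ pre , t′ , post , refl , cong (v ∷_) bottom-pre , bottom-post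

  -- What remains of the column (t , just c) once its bottom entry is erased.
  gapBelow : Maybe A → List Column
  gapBelow nothing  = []
  gapBelow (just a) = (just a , nothing) ∷ []

  gapBelow-notDoubleGap : ∀ t → All NotDoubleGap (gapBelow t)
  gapBelow-notDoubleGap nothing  = []
  gapBelow-notDoubleGap (just a) = ((λ ()) ∘ proj₁) ∷ []

  gapBelow-topRow : ∀ t c post → topRow (gapBelow t ++ post) ≡ topRow ((t , just c) ∷ post)
  gapBelow-topRow nothing  c post = refl
  gapBelow-topRow (just a) c post = refl

  gapBelow-bottomRow : ∀ t post → bottomRow (gapBelow t ++ post) ≡ bottomRow post
  gapBelow-bottomRow nothing  post = refl
  gapBelow-bottomRow (just a) post = refl

  gapBelow-cost : ∀ t c post → cost (gapBelow t ++ post) ≤ 1 + cost ((t , just c) ∷ post)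
  gapBelow-cost nothing  c post = ≤-trans (cost-∷-≥ (nothing , just c) post) (n≤1+n _)
  gapBelow-cost (just a) c post = s≤s (cost-∷-≥ (just a , just c) post)

  gapBelow-cost-unmatched : ∀ t c post →
    t ≡ just c ⊎ cost (gapBelow t ++ post) ≤ 0 + cost ((t , just c) ∷ post)
  gapBelow-cost-unmatched nothing  c post = inj₂ (cost-∷-≥ (nothing , just c) post)
  gapBelow-cost-unmatched (just a) c post with maybe-≡-dec _≟_ (just a) (just c)
  ... | yes a≡c = inj₁ a≡c
  ... | no  _   = inj₂ ≤-refl

  dropLastBottom : ∀ {U V c al} → IsAlignment U (V ∷ʳ c) al →
    ∃ λ al′ → IsAlignment U V al′ × cost al′ ≤ 1 + cost al ×
              (LastBottomInMatch c al ⊎ cost al′ ≤ cost al)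
  dropLastBottom {U} {V} {c} {al} (nd , top , bottom)
    with pre , t , post , refl , bottom-pre , bottom-post ← splitAtLastBottom V c al bottom
    = al′ , (nd′ , top′ , bottom′)
    , cost-++-monoʳ 1 pre (gapBelow-cost t c post)
    , matchedOrFree (gapBelow-cost-unmatched t c post)
    where
    al′ : List Column
    al′ = pre ++ gapBelow t ++ post

    nd′ : All NotDoubleGap al′
    nd′ with nd-pre , _ ∷ nd-post ← ++⁻ pre nd =
      ++⁺ nd-pre (++⁺ (gapBelow-notDoubleGap t) nd-post)

    top′ : topRow al′ ≡ U
    top′ = begin
      topRow al′                                 ≡⟨ topRow-++ pre _ ⟩
      topRow pre ++ topRow (gapBelow t ++ post)  ≡⟨ cong (topRow pre ++_) (gapBelow-topRow t c post) ⟩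
      topRow pre ++ topRow ((t , just c) ∷ post) ≡⟨ sym (topRow-++ pre _) ⟩
      topRow (pre ++ (t , just c) ∷ post)        ≡⟨ top ⟩
      U                                          ∎
      where open ≡-Reasoning

    bottom′ : bottomRow al′ ≡ V
    bottom′ = begin
      bottomRow al′                                   ≡⟨ bottomRow-++ pre _ ⟩
      bottomRow pre ++ bottomRow (gapBelow t ++ post) ≡⟨ cong₂ _++_ bottom-pre
                                                            (trans (gapBelow-bottomRow t post) bottom-post) ⟩
      V ++ []                                         ≡⟨ ++-identityʳ V ⟩
      V                                               ∎
      where open ≡-Reasoning

    matchedOrFree : t ≡ just c ⊎ cost (gapBelow t ++ post) ≤ 0 + cost ((t , just c) ∷ post) →
                    LastBottomInMatch c (pre ++ (t , just c) ∷ post) ⊎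
                    cost al′ ≤ cost (pre ++ (t , just c) ∷ post)
    matchedOrFree (inj₁ refl) = inj₁ (pre , post , refl , bottomRow≡[]⇒gaps post bottom-post)
    matchedOrFree (inj₂ le)   = inj₂ (cost-++-monoʳ 0 pre le)

  lev-∷ʳ-≤ : ∀ V c U → lev V U ≤ 1 + lev (V ∷ʳ c) U
  lev-∷ʳ-≤ V c U
    with al , aligned , cost≤lev ← levAlignment U (V ∷ʳ c)
    with al′ , aligned′ , cost′≤ , _ ← dropLastBottom aligned
    = ≤-trans (lev≤cost aligned′) (≤-trans cost′≤ (s≤s cost≤lev))

  optimal⇒cost≤lev : ∀ {U V al} → IsOptimal U V al → cost al ≤ lev V U
  optimal⇒cost≤lev {U} {V} (_ , minimal)
    with al , aligned , cost≤lev ← levAlignment U V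
    = ≤-trans (minimal al aligned) cost≤lev

proposition3 : {A : Set} (_≟_ : DecidableEquality A) (W : List A) → W ≢ [] →
    (d : ℕ) → 1 ≤ d → (xs : List A) (c : A) →
    Lev.InCN _≟_ W d (xs ∷ʳ c) →
    (Lev.lev _≟_ (xs ∷ʳ c) W ≡ d) ×
    (∀ al → Lev.IsOptimal _≟_ W (xs ∷ʳ c) al → Lev.LastBottomInMatch _≟_ c al)
proposition3 _≟_ W _ d _ xs c (x∈N , noPrefixInN) = lev≡d , lastMatched
  where
  open Lev _≟_
  open Alignments _≟_

  xs∉N : ¬ lev xs W ≤ d
  xs∉N = noPrefixInN xs c [] refl

  lev≡d : lev (xs ∷ʳ c) W ≡ d
  lev≡d = ≤-antisym x∈N (≤-pred (≤-trans (≰⇒> xs∉N) (lev-∷ʳ-≤ xs c W)))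

  lastMatched : ∀ al → IsOptimal W (xs ∷ʳ c) al → LastBottomInMatch c al
  lastMatched al optimal@(aligned , _) with dropLastBottom aligned
  ... | _   , _        , _ , inj₁ matched = matched
  ... | al′ , aligned′ , _ , inj₂ cost′≤  =
    contradiction (begin
      lev xs W        ≤⟨ lev≤cost aligned′ ⟩
      cost al′        ≤⟨ cost′≤ ⟩
      cost al         ≤⟨ optimal⇒cost≤lev optimal ⟩
      lev (xs ∷ʳ c) W ≤⟨ x∈N ⟩
      d               ∎) xs∉N
    where open ≤-Reasoning
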